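{- Let $k$ be a positive integer and let $C_{2k+1}$ be the circuit on $2k+1$ vertices. (1) If $(C_{2k+1},\sigma)$ is balanced, then $\chi_c((C_{2k+1},\sigma))=2+\frac1k$; otherwise $\chi_c((C_{2k+1},\sigma))=2$. Furthermore, $\chi((C_{2k+1},\sigma))=3$. (2) For any signed graph $(G,\sigma)$: $\chi((G,\sigma))=2$ if and only if $G$ is bipartite; furthermore, $\chi((G,\sigma))=\chi_c((G,\sigma))$ if $G$ is bipartite.
   Context: Graphs are simple and finite. A signed graph $(G,\sigma)$ is a graph $G$ with a map $\sigma:E(G)\to\{\pm1\}$. A circuit is balanced if it contains an even number of negative edges; $(G,\sigma)$ is balanced if every circuit is balanced. For $x\in\mathbb{R}$ and $r>0$, $[x]_r\in[0,r)$ is the remainder of $x$ modulo $r$ and $|x|_r=\min\{[x]_r,[-x]_r\}$. For positive integers $k\ge 2d$, a $(k,d)$-coloring of $(G,\sigma)$ is a map $c:V(G)\to\mathbb{Z}_k$ such that $|c(v)-\sigma(e)c(w)|_k\ge d$ for every edge $e=vw$. The circular chromatic number is $\chi_c((G,\sigma))=\inf\{k/d : (G,\sigma)\text{ has a }(k,d)\text{ -coloring}\}$, and the chromatic number $\chi((G,\sigma))$ is the minimum $k$ such that $(G,\sigma)$ has a $(k,1)$-coloring. -}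

module Defs where

open import Data.Nat as ℕ using (ℕ; zero; suc; _≤_; _<_; NonZero; _⊓_)
open import Data.Nat.Properties using (_<?_; 1+n≢n)
open import Data.Nat.Divisibility using (_∣_)
open import Data.Integer as ℤ using (ℤ; +_; _%ℕ_; -_)
open import Data.Rational as ℚ using (ℚ)
open import Data.Fin using (Fin; toℕ; fromℕ<) renaming (zero to fzero)
open import Data.List using (List; map; allFin)
open import Data.Nat.ListAction using (sum)
open import Data.Bool using (Bool)
open import Data.Product using (Σ; _×_; _,_; ∃₂)
open import Data.Sum using (_⊎_; inj₁; inj₂)
open import Function.Definitions using (Injective)
open import Relation.Nullary using (¬_; yes; no)
open import Relation.Binary.PropositionalEquality using (_≡_; _≢_; sym; trans)

record Graph : Set₁ where
  field
    n      : ℕ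
    Adj    : Fin n → Fin n → Set
    sym'   : ∀ {u v} → Adj u v → Adj v u
    irrefl : ∀ {u} → ¬ Adj u u
open Graph public

data Sign : Set where
  pos neg : Sign

sgn : Sign → ℤ
sgn pos = + 1
sgn neg = ℤ.-[1+ 0 ]

record Signature (G : Graph) : Set where
  field
    σ     : Fin (n G) → Fin (n G) → Sign
    σ-sym : ∀ u v → Adj G u v → σ u v ≡ σ v u
open Signature public

csuc : ∀ {m} → Fin (suc m) → Fin (suc m)
csuc {m} i with toℕ i <? m
... | yes p = fromℕ< (ℕ.s≤s p)
... | no _  = fzero

record Circuit (G : Graph) : Set where
  field
    l    : ℕ
    vtx  : Fin (suc (suc (suc l))) → Fin (n G)
    inj  : Injective _≡_ _≡_ vtx
    edge : ∀ i → Adj G (vtx i) (vtx (csuc i))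
open Circuit public

negInd : Sign → ℕ
negInd pos = 0
negInd neg = 1

negCount : {G : Graph} (s : Signature G) → Circuit G → ℕ
negCount s C = sum (map (λ i → negInd (σ s (vtx C i) (vtx C (csuc i)))) (allFin _))

BalancedCircuit : {G : Graph} → Signature G → Circuit G → Set
BalancedCircuit s C = 2 ∣ negCount s C

Balanced : {G : Graph} → Signature G → Set
Balanced {G} s = (C : Circuit G) → BalancedCircuit s C

-- |x|_k = min([x]_k, [-x]_k)   (only used for k > 0)
∣_∣[_] : ℤ → ℕ → ℕ
∣ x ∣[ zero ]  = 0
∣ x ∣[ suc k ] = (x %ℕ suc k) ⊓ ((- x) %ℕ suc k)

IsColoring : {G : Graph} → Signature G → (k d : ℕ) → (Fin (n G) → Fin k) → Set
IsColoring {G} s k d c =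
  ∀ u v → Adj G u v →
    d ≤ ∣ (+ toℕ (c u)) ℤ.- (sgn (σ s u v) ℤ.* (+ toℕ (c v))) ∣[ k ]

HasColoring : {G : Graph} → Signature G → (k d : ℕ) → Set
HasColoring {G} s k d =
  1 ≤ d × (2 ℕ.* d ≤ k) × Σ (Fin (n G) → Fin k) (IsColoring s k d)

-- k / d as a rational (d = 0 never occurs for colorings)
frac : ℕ → ℕ → ℚ
frac k zero    = ℚ.0ℚ
frac k (suc d) = (+ k) ℚ./ suc d

IsChromaticNumber : {G : Graph} → Signature G → ℕ → Set
IsChromaticNumber s m = HasColoring s m 1 × (∀ j → HasColoring s j 1 → m ≤ j)

IsCircularChromaticNumber : {G : Graph} → Signature G → ℚ → Set
IsCircularChromaticNumber s r =
  (∀ k d → HasColoring s k d → r ℚ.≤ frac k d) ×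
  (∀ q → r ℚ.< q → ∃₂ λ k d → HasColoring s k d × frac k d ℚ.< q)

Bipartite : Graph → Set
Bipartite G = Σ (Fin (n G) → Bool) λ f → ∀ u v → Adj G u v → f u ≢ f v

CStep : (k : ℕ) → Fin (suc (2 ℕ.* k)) → Fin (suc (2 ℕ.* k)) → Set
CStep k u v = (suc (toℕ u) ≡ toℕ v) ⊎ ((toℕ u ≡ 2 ℕ.* k) × (toℕ v ≡ 0))

private
  ⊎-swap : ∀ {A B : Set} → A ⊎ B → B ⊎ A
  ⊎-swap (inj₁ a) = inj₂ a
  ⊎-swap (inj₂ b) = inj₁ b

  step-irrefl : ∀ k .{{_ : NonZero k}} {u} → ¬ CStep k u u
  step-irrefl k (inj₁ p) = 1+n≢n p
  step-irrefl (suc k) (inj₂ (p , q)) with trans (sym p) q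
  ... | ()

Cycle : (k : ℕ) .{{_ : NonZero k}} → Graph
Cycle k = record
  { n      = suc (2 ℕ.* k)
  ; Adj    = λ u v → CStep k u v ⊎ CStep k v u
  ; sym'   = ⊎-swap
  ; irrefl = λ { (inj₁ p) → step-irrefl k p ; (inj₂ p) → step-irrefl k p }
  }

-- Switching a signature at a vertex u (negating the signs of the edges at u)
-- preserves the sign of every circuit and turns a (p,q)-coloring c into one with
-- c(u) replaced by −c(u). Switching C_{2k+1} along the path 0, 1, …, 2k makes
-- every edge positive except {2k, 0}, whose sign is then the sign of the circuit.
-- A balanced cycle thus behaves like the positive one: the residues of
-- c(i+1) − c(i) modulo p lie in [q, p − q] and add up to a multiple of p, which
-- forces (2k+1)q ≤ kp, and j ↦ jk is a (2k+1,k)-coloring. An unbalanced cycle has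
-- the (4,2)-coloring ±1, while p/q ≥ 2 holds for every coloring. Modulo 2 the
-- signs are irrelevant, so (2,1)-colorings are bipartitions; C_{2k+1} has none.

module Submission where

open import Defs
open import Data.Nat using (ℕ; NonZero)
open import Data.Integer using (+_)
open import Data.Rational using (_+_; _/_)
open import Data.Product using (_×_)
open import Function.Bundles using (_⇔_)
open import Relation.Nullary using (¬_)

open import Algebra.Bundles using (CommutativeMonoid)
import Algebra.Properties.CommutativeMonoid.Sum as CommutativeMonoidSum
import Algebra.Properties.Semiring.Sum as SemiringSum
open import Data.Bool using (Bool; true; false)
open import Data.Fin as Fin using (Fin; toℕ; fromℕ; fromℕ<; inject₁; cast)
import Data.Fin.Properties as FinP
open import Data.Integer as ℤ using (ℤ; -_; _%ℕ_; _/ℕ_; +≤+)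
import Data.Integer.Properties as ℤP
open import Data.Integer.DivMod using (n%ℕd<d; a≡a%ℕn+[a/ℕn]*n)
open import Data.Integer.Tactic.RingSolver using (solve-∀)
open import Data.List using (tabulate; map)
open import Data.List.Properties using (map-tabulate)
open import Data.Nat as ℕ using (zero; suc; _≤_; _<_; _⊓_; z≤n; s≤s)
import Data.Nat.Properties as ℕP
open import Data.Nat.Divisibility using (_∣_; divides; ∣-refl; ∣m∣n⇒∣m+n)
open import Data.Nat.DivMod using (_mod_; m<n⇒m%n≡m)
import Data.Nat.ListAction as List
import Data.Nat.Tactic.RingSolver as ℕSolver
open import Data.Product using (_,_; proj₁; proj₂; ∃-syntax; ∃₂)
open import Data.Rational as ℚ using (toℚᵘ)
import Data.Rational.Properties as ℚP
open import Data.Rational.Unnormalised as ℚᵘ using (mkℚᵘ; *≡*; *≤*)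
import Data.Rational.Unnormalised.Properties as ℚᵘP
open import Data.Sum using (inj₁; inj₂)
open import Data.Vec.Functional using (Vector)
open import Function using (_∘_)
open import Function.Bundles using (Equivalence; mk⇔)
open import Relation.Nullary using (yes; no; contradiction)
open import Relation.Binary.PropositionalEquality
  using (_≡_; _≢_; refl; sym; trans; cong; cong₂; subst; subst₂; isEquivalence; module ≡-Reasoning)

infixl 7 _·_
_·_ : Sign → Sign → Sign
pos · t = t
neg · pos = neg
neg · neg = pos

·-assoc : ∀ a b c → (a · b) · c ≡ a · (b · c)
·-assoc pos b c = refl
·-assoc neg pos c = refl
·-assoc neg neg pos = refl
·-assoc neg neg neg = refl

·-comm : ∀ a b → a · b ≡ b · a
·-comm pos pos = refl
·-comm pos neg = refl
·-comm neg pos = refl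
·-comm neg neg = refl

·-identityʳ : ∀ a → a · pos ≡ a
·-identityʳ pos = refl
·-identityʳ neg = refl

·-inverse : ∀ a → a · a ≡ pos
·-inverse pos = refl
·-inverse neg = refl

·-cancelˡ : ∀ a b → a · (a · b) ≡ b
·-cancelˡ a b = trans (sym (·-assoc a a b)) (cong (_· b) (·-inverse a))

·-commutativeMonoid : CommutativeMonoid _ _
·-commutativeMonoid = record
  { isCommutativeMonoid = record
    { isMonoid = record
      { isSemigroup = record
        { isMagma = record { isEquivalence = isEquivalence ; ∙-cong = cong₂ _·_ }
        ; assoc = ·-assoc }
      ; identity = (λ _ → refl) , ·-identityʳ }
    ; comm = ·-comm } }

open CommutativeMonoidSum ·-commutativeMonoid using () renaming
  ( sum to ∏; sum-cong-≗ to ∏-cong; ∑-distrib-+ to ∏-distrib-·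
  ; sum-init-last to ∏-init-last; sum-replicate-zero to ∏-replicate-pos )

sgn-· : ∀ a b → sgn (a · b) ≡ sgn a ℤ.* sgn b
sgn-· pos pos = refl
sgn-· pos neg = refl
sgn-· neg pos = refl
sgn-· neg neg = refl

sgn-inverse : ∀ a → sgn a ℤ.* sgn a ≡ ℤ.1ℤ
sgn-inverse pos = refl
sgn-inverse neg = refl

parity : ℕ → Sign
parity zero = pos
parity (suc zero) = neg
parity (suc (suc n)) = parity n

parity-suc : ∀ n → parity (suc n) ≡ neg · parity n
parity-suc zero = refl
parity-suc (suc zero) = refl
parity-suc (suc (suc n)) = parity-suc n

parity-+ : ∀ m n → parity (m ℕ.+ n) ≡ parity m · parity n
parity-+ zero n = refl
parity-+ (suc zero) n = parity-suc n
parity-+ (suc (suc m)) n = parity-+ m n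

parity-*2 : ∀ q → parity (q ℕ.* 2) ≡ pos
parity-*2 zero = refl
parity-*2 (suc q) = parity-*2 q

even⇒parity≡pos : ∀ {n} → 2 ∣ n → parity n ≡ pos
even⇒parity≡pos (divides q refl) = parity-*2 q

parity≡pos⇒even : ∀ n → parity n ≡ pos → 2 ∣ n
parity≡pos⇒even zero _ = divides 0 refl
parity≡pos⇒even (suc (suc n)) p = ∣m∣n⇒∣m+n ∣-refl (parity≡pos⇒even n p)

parity-negInd : ∀ a → parity (negInd a) ≡ a
parity-negInd pos = refl
parity-negInd neg = refl

toℕ-csuc : ∀ {m} (i : Fin (suc m)) → toℕ i < m → toℕ (csuc i) ≡ suc (toℕ i)
toℕ-csuc {m} i i<m with toℕ i ℕP.<? m
... | yes i<m = FinP.toℕ-fromℕ< (ℕ.s≤s i<m)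
... | no i≮m = contradiction i<m i≮m

csuc-last : ∀ {m} (i : Fin (suc m)) → toℕ i ≡ m → csuc i ≡ Fin.zero
csuc-last {m} i i≡m with toℕ i ℕP.<? m
... | yes i<m = contradiction i≡m (ℕP.<⇒≢ i<m)
... | no _ = refl

csuc-inject₁ : ∀ {m} (i : Fin m) → csuc (inject₁ i) ≡ Fin.suc i
csuc-inject₁ {m} i = FinP.toℕ-injective (begin
  toℕ (csuc (inject₁ i)) ≡⟨ toℕ-csuc (inject₁ i) (subst (_< m) (sym (FinP.toℕ-inject₁ i)) (FinP.toℕ<n i)) ⟩
  suc (toℕ (inject₁ i))  ≡⟨ cong suc (FinP.toℕ-inject₁ i) ⟩
  suc (toℕ i)            ∎)
  where open ≡-Reasoning

csuc-cast : ∀ {m m′} (eq : suc m ≡ suc m′) (i : Fin (suc m)) → csuc (cast eq i) ≡ cast eq (csuc i)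
csuc-cast refl i = trans (cong csuc (FinP.cast-is-id refl i)) (sym (FinP.cast-is-id refl (csuc i)))

module _ {c ℓ} (M : CommutativeMonoid c ℓ) where
  open CommutativeMonoid M using (Carrier; _≈_; _∙_; comm; reflexive; setoid)
  open CommutativeMonoidSum M
  open import Relation.Binary.Reasoning.Setoid setoid

  sum-∘csuc : ∀ {m} (f : Vector Carrier (suc m)) → sum (f ∘ csuc) ≈ sum f
  sum-∘csuc {m} f = begin
    sum (f ∘ csuc)                               ≈⟨ sum-init-last (f ∘ csuc) ⟩
    sum (f ∘ csuc ∘ inject₁) ∙ f (csuc (fromℕ m)) ≡⟨ cong₂ _∙_ (sum-cong-≗ (cong f ∘ csuc-inject₁))
                                                      (cong f (csuc-last (fromℕ m) (FinP.toℕ-fromℕ m))) ⟩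
    sum (f ∘ Fin.suc) ∙ f Fin.zero               ≈⟨ comm _ _ ⟩
    sum f                                        ∎

  sum-∘cast : ∀ {m m′} (eq : m ≡ m′) (f : Vector Carrier m′) → sum (f ∘ cast eq) ≈ sum f
  sum-∘cast refl f = reflexive (sum-cong-≗ (cong f ∘ FinP.cast-is-id refl))

-- Arithmetic modulo p

module _ (m : ℕ) where
  private
    P = suc m

  %ℕ-+-unique : ∀ {x} r (Q : ℤ) → r < P → x ≡ + r ℤ.+ Q ℤ.* + P → x %ℕ P ≡ r
  %ℕ-+-unique {x} r Q r<P x≡r+QP = ℤP.+-injective (ℤP.i-j≡0⇒i≡j (+ r′) (+ r) r′-r≡0)
    where
    r′ = x %ℕ P
    D = Q ℤ.- x /ℕ P
    r′-r≡DP : + r′ ℤ.- + r ≡ D ℤ.* + P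
    r′-r≡DP = begin
      + r′ ℤ.- + r
        ≡⟨ regroup (+ r′) (+ r) (x /ℕ P) Q (+ P) ⟩
      (+ r′ ℤ.+ x /ℕ P ℤ.* + P) ℤ.- (+ r ℤ.+ Q ℤ.* + P) ℤ.+ D ℤ.* + P
        ≡⟨ cong₂ (λ a b → a ℤ.- b ℤ.+ D ℤ.* + P) (sym (a≡a%ℕn+[a/ℕn]*n x P)) (sym x≡r+QP) ⟩
      x ℤ.- x ℤ.+ D ℤ.* + P
        ≡⟨ cancel x (D ℤ.* + P) ⟩
      D ℤ.* + P ∎
      where
      open ≡-Reasoning
      regroup : ∀ a b q Q p → a ℤ.- b ≡ (a ℤ.+ q ℤ.* p) ℤ.- (b ℤ.+ Q ℤ.* p) ℤ.+ (Q ℤ.- q) ℤ.* p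
      regroup = solve-∀
      cancel : ∀ a b → a ℤ.- a ℤ.+ b ≡ b
      cancel = solve-∀
    ∣D∣P<P : ℤ.∣ D ∣ ℕ.* P < 1 ℕ.* P
    ∣D∣P<P = begin-strict
      ℤ.∣ D ∣ ℕ.* P        ≡⟨ sym (trans (cong ℤ.∣_∣ r′-r≡DP) (ℤP.abs-* D (+ P))) ⟩
      ℤ.∣ + r′ ℤ.- + r ∣  ≡⟨ cong ℤ.∣_∣ (ℤP.[+m]-[+n]≡m⊖n r′ r) ⟩
      ℤ.∣ r′ ℤ.⊖ r ∣      ≤⟨ ℤP.∣m⊝n∣≤m⊔n r′ r ⟩
      r′ ℕ.⊔ r            <⟨ ℕP.⊔-lub (n%ℕd<d x P) r<P ⟩
      P                   ≡⟨ sym (ℕP.*-identityˡ P) ⟩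
      1 ℕ.* P             ∎
      where open ℕP.≤-Reasoning
    r′-r≡0 : + r′ ℤ.- + r ≡ + 0
    r′-r≡0 = trans r′-r≡DP
      (cong (ℤ._* + P) (ℤP.∣i∣≡0⇒i≡0 {D} (ℕP.n<1⇒n≡0 (ℕP.*-cancelʳ-< P ℤ.∣ D ∣ 1 ∣D∣P<P))))

  %ℕ-+-* : ∀ x t → (x ℤ.+ t ℤ.* + P) %ℕ P ≡ x %ℕ P
  %ℕ-+-* x t = %ℕ-+-unique (x %ℕ P) (x /ℕ P ℤ.+ t) (n%ℕd<d x P) (begin
    x ℤ.+ t ℤ.* + P                                 ≡⟨ cong (ℤ._+ t ℤ.* + P) (a≡a%ℕn+[a/ℕn]*n x P) ⟩
    + (x %ℕ P) ℤ.+ x /ℕ P ℤ.* + P ℤ.+ t ℤ.* + P     ≡⟨ regroup (+ (x %ℕ P)) (x /ℕ P) t (+ P) ⟩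
    + (x %ℕ P) ℤ.+ (x /ℕ P ℤ.+ t) ℤ.* + P           ∎)
    where
    open ≡-Reasoning
    regroup : ∀ r q t p → r ℤ.+ q ℤ.* p ℤ.+ t ℤ.* p ≡ r ℤ.+ (q ℤ.+ t) ℤ.* p
    regroup = solve-∀

  %ℕ-neg : ∀ x → 1 ≤ x %ℕ P → (- x) %ℕ P ≡ P ℕ.∸ x %ℕ P
  %ℕ-neg x r≥1 = %ℕ-+-unique (P ℕ.∸ r) (- (x /ℕ P) ℤ.- ℤ.1ℤ) (ℕP.∸-monoʳ-< r≥1 r≤P) (begin
    - x                                                 ≡⟨ cong -_ (a≡a%ℕn+[a/ℕn]*n x P) ⟩
    - (+ r ℤ.+ x /ℕ P ℤ.* + P)                          ≡⟨ regroup (+ r) (x /ℕ P) (+ P) ⟩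
    (+ P ℤ.- + r) ℤ.+ (- (x /ℕ P) ℤ.- ℤ.1ℤ) ℤ.* + P     ≡⟨ cong (ℤ._+ (- (x /ℕ P) ℤ.- ℤ.1ℤ) ℤ.* + P)
                                                            (trans (ℤP.[+m]-[+n]≡m⊖n P r) (ℤP.⊖-≥ r≤P)) ⟩
    + (P ℕ.∸ r) ℤ.+ (- (x /ℕ P) ℤ.- ℤ.1ℤ) ℤ.* + P       ∎)
    where
    open ≡-Reasoning
    r = x %ℕ P
    r≤P = ℕP.<⇒≤ (n%ℕd<d x P)
    regroup : ∀ r q p → - (r ℤ.+ q ℤ.* p) ≡ (p ℤ.- r) ℤ.+ (- q ℤ.- ℤ.1ℤ) ℤ.* p
    regroup = solve-∀

  ∣∣-+-* : ∀ x t → ∣ x ℤ.+ t ℤ.* + P ∣[ P ] ≡ ∣ x ∣[ P ]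
  ∣∣-+-* x t = cong₂ _⊓_ (%ℕ-+-* x t)
    (trans (cong (_%ℕ P) (negate x t (+ P))) (%ℕ-+-* (- x) (- t)))
    where
    negate : ∀ x t p → - (x ℤ.+ t ℤ.* p) ≡ - x ℤ.+ - t ℤ.* p
    negate = solve-∀

  ∣∣-neg : ∀ x → ∣ - x ∣[ P ] ≡ ∣ x ∣[ P ]
  ∣∣-neg x = trans (cong (λ y → ((- x) %ℕ P) ⊓ (y %ℕ P)) (ℤP.neg-involutive x)) (ℕP.⊓-comm _ _)

  ∣∣-sgn : ∀ a x → ∣ sgn a ℤ.* x ∣[ P ] ≡ ∣ x ∣[ P ]
  ∣∣-sgn pos x = cong ∣_∣[ P ] (ℤP.*-identityˡ x)
  ∣∣-sgn neg x = trans (cong ∣_∣[ P ] (ℤP.-1*i≡-i x)) (∣∣-neg x)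

  ∣∣-residues : ∀ e a b → ∣ + (a %ℕ P) ℤ.- e ℤ.* + (b %ℕ P) ∣[ P ] ≡ ∣ a ℤ.- e ℤ.* b ∣[ P ]
  ∣∣-residues e a b = sym (begin
    ∣ a ℤ.- e ℤ.* b ∣[ P ]
      ≡⟨ cong₂ (λ a b → ∣ a ℤ.- e ℤ.* b ∣[ P ]) (a≡a%ℕn+[a/ℕn]*n a P) (a≡a%ℕn+[a/ℕn]*n b P) ⟩
    ∣ (ra ℤ.+ qa ℤ.* + P) ℤ.- e ℤ.* (rb ℤ.+ qb ℤ.* + P) ∣[ P ]
      ≡⟨ cong ∣_∣[ P ] (regroup ra qa rb qb e (+ P)) ⟩
    ∣ (ra ℤ.- e ℤ.* rb) ℤ.+ (qa ℤ.- e ℤ.* qb) ℤ.* + P ∣[ P ]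
      ≡⟨ ∣∣-+-* (ra ℤ.- e ℤ.* rb) (qa ℤ.- e ℤ.* qb) ⟩
    ∣ ra ℤ.- e ℤ.* rb ∣[ P ] ∎)
    where
    open ≡-Reasoning
    ra = + (a %ℕ P)
    rb = + (b %ℕ P)
    qa = a /ℕ P
    qb = b /ℕ P
    regroup : ∀ ra qa rb qb e p →
      (ra ℤ.+ qa ℤ.* p) ℤ.- e ℤ.* (rb ℤ.+ qb ℤ.* p) ≡ (ra ℤ.- e ℤ.* rb) ℤ.+ (qa ℤ.- e ℤ.* qb) ℤ.* p
    regroup = solve-∀

  ≤∣∣⇔ : ∀ {q} x → 1 ≤ q → q ≤ ∣ x ∣[ P ] ⇔ (q ≤ x %ℕ P × x %ℕ P ℕ.+ q ≤ P)
  ≤∣∣⇔ {q} x q≥1 = mk⇔ to from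
    where
    r = x %ℕ P
    to : q ≤ ∣ x ∣[ P ] → q ≤ r × r ℕ.+ q ≤ P
    to q≤∣x∣ = q≤r , subst (_≤ P) (ℕP.+-comm q r)
      (ℕP.m≤o∸n⇒m+n≤o q (ℕP.<⇒≤ (n%ℕd<d x P))
        (subst (q ≤_) (%ℕ-neg x (ℕP.≤-trans q≥1 q≤r)) (ℕP.≤-trans q≤∣x∣ (ℕP.m⊓n≤n r _))))
      where q≤r = ℕP.≤-trans q≤∣x∣ (ℕP.m⊓n≤m r _)
    from : q ≤ r × r ℕ.+ q ≤ P → q ≤ ∣ x ∣[ P ]
    from (q≤r , r+q≤P) = ℕP.⊓-glb q≤r
      (subst (q ≤_) (sym (%ℕ-neg x (ℕP.≤-trans q≥1 q≤r)))
        (ℕP.m+n≤o⇒m≤o∸n q (subst (_≤ P) (ℕP.+-comm r q) r+q≤P)))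

  ∣∣-swap : ∀ a x y → ∣ y ℤ.- sgn a ℤ.* x ∣[ P ] ≡ ∣ x ℤ.- sgn a ℤ.* y ∣[ P ]
  ∣∣-swap pos x y = trans (cong ∣_∣[ P ] (flip x y)) (∣∣-neg (x ℤ.- + 1 ℤ.* y))
    where
    flip : ∀ x y → y ℤ.- + 1 ℤ.* x ≡ - (x ℤ.- + 1 ℤ.* y)
    flip = solve-∀
  ∣∣-swap neg x y = cong ∣_∣[ P ] (flip x y)
    where
    flip : ∀ x y → y ℤ.- - + 1 ℤ.* x ≡ x ℤ.- - + 1 ℤ.* y
    flip = solve-∀

module ℕΣ = CommutativeMonoidSum ℕP.+-0-commutativeMonoid
module ℤΣ = SemiringSum ℤP.+-*-semiring

∑-mono-≤ : ∀ {n} {f g : Vector ℕ n} → (∀ i → f i ≤ g i) → ℕΣ.sum f ≤ ℕΣ.sum g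
∑-mono-≤ {zero} f≤g = ℕ.z≤n
∑-mono-≤ {suc n} f≤g = ℕP.+-mono-≤ (f≤g Fin.zero) (∑-mono-≤ (f≤g ∘ Fin.suc))

∑-const : ∀ n c → ℕΣ.sum {n} (λ _ → c) ≡ n ℕ.* c
∑-const zero c = refl
∑-const (suc n) c = cong (c ℕ.+_) (∑-const n c)

pos-∑ : ∀ {n} (f : Vector ℕ n) → + ℕΣ.sum f ≡ ℤΣ.sum (+_ ∘ f)
pos-∑ {zero} f = refl
pos-∑ {suc n} f = trans (ℤP.pos-+ (f Fin.zero) _) (cong (ℤ._+_ (+ f Fin.zero)) (pos-∑ (f ∘ Fin.suc)))

-- If m > k, the upper bound leaves (2k+1)p − (k+1)p = kp for (2k+1)q.
odd-multiple-bound : ∀ k p q m → suc (2 ℕ.* k) ℕ.* q ≤ m ℕ.* p →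
  m ℕ.* p ℕ.+ suc (2 ℕ.* k) ℕ.* q ≤ suc (2 ℕ.* k) ℕ.* p → suc (2 ℕ.* k) ℕ.* q ≤ k ℕ.* p
odd-multiple-bound k p q m nq≤mp mp+nq≤np with m ℕP.≤? k
... | yes m≤k = ℕP.≤-trans nq≤mp (ℕP.*-monoˡ-≤ p m≤k)
... | no m≰k = ℕP.+-cancelˡ-≤ (suc k ℕ.* p) _ _ (begin
  suc k ℕ.* p ℕ.+ N ℕ.* q   ≤⟨ ℕP.+-monoˡ-≤ (N ℕ.* q) (ℕP.*-monoˡ-≤ p (ℕP.≰⇒> m≰k)) ⟩
  m ℕ.* p ℕ.+ N ℕ.* q       ≤⟨ mp+nq≤np ⟩
  N ℕ.* p                   ≡⟨ split k p ⟩
  suc k ℕ.* p ℕ.+ k ℕ.* p   ∎)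
  where
  open ℕP.≤-Reasoning
  N = suc (2 ℕ.* k)
  split : ∀ k p → suc (2 ℕ.* k) ℕ.* p ≡ suc k ℕ.* p ℕ.+ k ℕ.* p
  split = ℕSolver.solve-∀

module _ (m : ℕ) where
  private
    P = suc m

  ∑-residues-multiple : ∀ {n} (x : Vector ℤ (suc n)) →
    ∃[ t ] ℕΣ.sum (λ i → (x (csuc i) ℤ.- x i) %ℕ P) ≡ t ℕ.* P
  ∑-residues-multiple x = ℤ.∣ - ∑Q ∣ , (begin
    ℕΣ.sum d                  ≡⟨ cong ℤ.∣_∣ +S≡-∑Q*P ⟩
    ℤ.∣ - ∑Q ℤ.* + P ∣        ≡⟨ ℤP.abs-* (- ∑Q) (+ P) ⟩
    ℤ.∣ - ∑Q ∣ ℕ.* P          ∎)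
    where
    open ≡-Reasoning
    e = λ i → x (csuc i) ℤ.- x i
    d = λ i → e i %ℕ P
    Q = λ i → e i /ℕ P
    ∑Q = ℤΣ.sum Q
    ∑x = ℤΣ.sum x
    step : ∀ i → + d i ℤ.+ x i ℤ.+ Q i ℤ.* + P ≡ x (csuc i)
    step i = begin
      + d i ℤ.+ x i ℤ.+ Q i ℤ.* + P     ≡⟨ regroup (+ d i) (x i) (Q i ℤ.* + P) ⟩
      (+ d i ℤ.+ Q i ℤ.* + P) ℤ.+ x i   ≡⟨ cong (ℤ._+ x i) (sym (a≡a%ℕn+[a/ℕn]*n (e i) P)) ⟩
      x (csuc i) ℤ.- x i ℤ.+ x i        ≡⟨ cancel (x (csuc i)) (x i) ⟩
      x (csuc i)                        ∎
      where
      regroup : ∀ a b c → a ℤ.+ b ℤ.+ c ≡ (a ℤ.+ c) ℤ.+ b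
      regroup = solve-∀
      cancel : ∀ a b → a ℤ.- b ℤ.+ b ≡ a
      cancel = solve-∀
    telescope : + ℕΣ.sum d ℤ.+ ∑x ℤ.+ ∑Q ℤ.* + P ≡ ∑x
    telescope = begin
      + ℕΣ.sum d ℤ.+ ∑x ℤ.+ ∑Q ℤ.* + P
        ≡⟨ cong₂ (λ a b → a ℤ.+ ∑x ℤ.+ b) (pos-∑ d) (ℤΣ.*-distribʳ-sum (+ P) Q) ⟩
      ℤΣ.sum (+_ ∘ d) ℤ.+ ∑x ℤ.+ ℤΣ.sum (λ i → Q i ℤ.* + P)
        ≡⟨ cong (ℤ._+ ℤΣ.sum (λ i → Q i ℤ.* + P)) (sym (ℤΣ.∑-distrib-+ (+_ ∘ d) x)) ⟩
      ℤΣ.sum (λ i → + d i ℤ.+ x i) ℤ.+ ℤΣ.sum (λ i → Q i ℤ.* + P)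
        ≡⟨ sym (ℤΣ.∑-distrib-+ (λ i → + d i ℤ.+ x i) (λ i → Q i ℤ.* + P)) ⟩
      ℤΣ.sum (λ i → + d i ℤ.+ x i ℤ.+ Q i ℤ.* + P)
        ≡⟨ ℤΣ.sum-cong-≗ step ⟩
      ℤΣ.sum (x ∘ csuc)
        ≡⟨ sum-∘csuc ℤP.+-0-commutativeMonoid x ⟩
      ∑x ∎
    +S≡-∑Q*P : + ℕΣ.sum d ≡ - ∑Q ℤ.* + P
    +S≡-∑Q*P = begin
      + ℕΣ.sum d
        ≡⟨ isolate (+ ℕΣ.sum d) ∑x (∑Q ℤ.* + P) ⟩
      (+ ℕΣ.sum d ℤ.+ ∑x ℤ.+ ∑Q ℤ.* + P) ℤ.- ∑x ℤ.- ∑Q ℤ.* + P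
        ≡⟨ cong (λ a → a ℤ.- ∑x ℤ.- ∑Q ℤ.* + P) telescope ⟩
      ∑x ℤ.- ∑x ℤ.- ∑Q ℤ.* + P
        ≡⟨ cancel ∑x ∑Q (+ P) ⟩
      - ∑Q ℤ.* + P ∎
      where
      isolate : ∀ a b c → a ≡ (a ℤ.+ b ℤ.+ c) ℤ.- b ℤ.- c
      isolate = solve-∀
      cancel : ∀ a q p → a ℤ.- a ℤ.- q ℤ.* p ≡ - q ℤ.* p
      cancel = solve-∀

  odd-cyclic-sequence-bound : ∀ k {q} → 1 ≤ q → (x : Vector ℤ (suc (2 ℕ.* k))) →
    (∀ i → q ≤ ∣ x (csuc i) ℤ.- x i ∣[ P ]) → suc (2 ℕ.* k) ℕ.* q ≤ k ℕ.* P
  odd-cyclic-sequence-bound k {q} q≥1 x gap =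
    odd-multiple-bound k P q t (subst (N ℕ.* q ≤_) S≡tP lower)
      (subst (λ s → s ℕ.+ N ℕ.* q ≤ N ℕ.* P) S≡tP upper)
    where
    open ℕP.≤-Reasoning
    N = suc (2 ℕ.* k)
    d = λ i → (x (csuc i) ℤ.- x i) %ℕ P
    S = ℕΣ.sum d
    t = proj₁ (∑-residues-multiple x)
    S≡tP = proj₂ (∑-residues-multiple x)
    bounds : ∀ i → q ≤ d i × d i ℕ.+ q ≤ P
    bounds i = Equivalence.to (≤∣∣⇔ m (x (csuc i) ℤ.- x i) q≥1) (gap i)
    lower : N ℕ.* q ≤ S
    lower = subst (_≤ S) (∑-const N q) (∑-mono-≤ (proj₁ ∘ bounds))
    upper : S ℕ.+ N ℕ.* q ≤ N ℕ.* P
    upper = begin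
      S ℕ.+ N ℕ.* q                    ≡⟨ cong (S ℕ.+_) (sym (∑-const N q)) ⟩
      S ℕ.+ ℕΣ.sum {N} (λ _ → q)       ≡⟨ sym (ℕΣ.∑-distrib-+ d (λ _ → q)) ⟩
      ℕΣ.sum (λ i → d i ℕ.+ q)         ≤⟨ ∑-mono-≤ (proj₂ ∘ bounds) ⟩
      ℕΣ.sum {N} (λ _ → P)             ≡⟨ ∑-const N P ⟩
      N ℕ.* P                          ∎

-- Switching

record Switching {G : Graph} (s s′ : Signature G) (τ : Fin (n G) → Sign) : Set where
  field
    switched : ∀ u v → Adj G u v → σ s′ u v ≡ τ u · σ s u v · τ v
open Switching public

switching-sym : ∀ {G} {s s′ : Signature G} {τ} → Switching s s′ τ → Switching s′ s τ
switching-sym {s = s} {s′} {τ} sw = record { switched = λ u v adj →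
  trans (unswitch (τ u) (σ s u v) (τ v)) (sym (cong (λ t → τ u · t · τ v) (switched sw u v adj))) }
  where
  unswitch : ∀ a b c → b ≡ a · (a · b · c) · c
  unswitch pos pos pos = refl
  unswitch pos pos neg = refl
  unswitch pos neg pos = refl
  unswitch pos neg neg = refl
  unswitch neg pos pos = refl
  unswitch neg pos neg = refl
  unswitch neg neg pos = refl
  unswitch neg neg neg = refl

residue : ∀ m → ℤ → Fin (suc m)
residue m x = fromℕ< (n%ℕd<d x (suc m))

toℕ-residue : ∀ m x → toℕ (residue m x) ≡ x %ℕ suc m
toℕ-residue m x = FinP.toℕ-fromℕ< (n%ℕd<d x (suc m))

switchColoring : ∀ {V : Set} {m} → (V → Sign) → (V → Fin (suc m)) → V → Fin (suc m)
switchColoring {m = m} τ c u = residue m (sgn (τ u) ℤ.* + toℕ (c u))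

sgn-switch : ∀ a b c x y → sgn a ℤ.* y ℤ.- sgn (a · b · c) ℤ.* (sgn c ℤ.* x) ≡ sgn a ℤ.* (y ℤ.- sgn b ℤ.* x)
sgn-switch a b c x y = begin
  A ℤ.* y ℤ.- sgn (a · b · c) ℤ.* (C ℤ.* x) ≡⟨ cong (λ z → A ℤ.* y ℤ.- z ℤ.* (C ℤ.* x))
                                                 (trans (sgn-· (a · b) c) (cong (ℤ._* C) (sgn-· a b))) ⟩
  A ℤ.* y ℤ.- A ℤ.* B ℤ.* C ℤ.* (C ℤ.* x)     ≡⟨ regroup A B C x y ⟩
  A ℤ.* (y ℤ.- B ℤ.* (C ℤ.* C) ℤ.* x)         ≡⟨ cong (λ z → A ℤ.* (y ℤ.- B ℤ.* z ℤ.* x)) (sgn-inverse c) ⟩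
  A ℤ.* (y ℤ.- B ℤ.* ℤ.1ℤ ℤ.* x)              ≡⟨ cong (λ z → A ℤ.* (y ℤ.- z ℤ.* x)) (ℤP.*-identityʳ B) ⟩
  A ℤ.* (y ℤ.- B ℤ.* x)                       ∎
  where
  open ≡-Reasoning
  A = sgn a
  B = sgn b
  C = sgn c
  regroup : ∀ A B C x y → A ℤ.* y ℤ.- A ℤ.* B ℤ.* C ℤ.* (C ℤ.* x) ≡ A ℤ.* (y ℤ.- B ℤ.* (C ℤ.* C) ℤ.* x)
  regroup = solve-∀

switch-IsColoring : ∀ {G} {s s′ : Signature G} {τ} m {d c} → Switching s s′ τ →
  IsColoring s (suc m) d c → IsColoring s′ (suc m) d (switchColoring τ c)
switch-IsColoring {s = s} {s′} {τ} m {d} {c} sw col u v adj = subst (d ≤_) (sym (begin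
  ∣ + toℕ (c′ u) ℤ.- sgn (σ s′ u v) ℤ.* + toℕ (c′ v) ∣[ P ]
    ≡⟨ cong₂ (λ a b → ∣ + a ℤ.- sgn (σ s′ u v) ℤ.* + b ∣[ P ])
             (toℕ-residue m (T u ℤ.* cu)) (toℕ-residue m (T v ℤ.* cv)) ⟩
  ∣ + ((T u ℤ.* cu) %ℕ P) ℤ.- sgn (σ s′ u v) ℤ.* + ((T v ℤ.* cv) %ℕ P) ∣[ P ]
    ≡⟨ ∣∣-residues m (sgn (σ s′ u v)) (T u ℤ.* cu) (T v ℤ.* cv) ⟩
  ∣ T u ℤ.* cu ℤ.- sgn (σ s′ u v) ℤ.* (T v ℤ.* cv) ∣[ P ]
    ≡⟨ cong (λ a → ∣ T u ℤ.* cu ℤ.- sgn a ℤ.* (T v ℤ.* cv) ∣[ P ]) (switched sw u v adj) ⟩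
  ∣ T u ℤ.* cu ℤ.- sgn (τ u · σ s u v · τ v) ℤ.* (T v ℤ.* cv) ∣[ P ]
    ≡⟨ cong ∣_∣[ P ] (sgn-switch (τ u) (σ s u v) (τ v) cv cu) ⟩
  ∣ T u ℤ.* (cu ℤ.- sgn (σ s u v) ℤ.* cv) ∣[ P ]
    ≡⟨ ∣∣-sgn m (τ u) _ ⟩
  ∣ cu ℤ.- sgn (σ s u v) ℤ.* cv ∣[ P ] ∎)) (col u v adj)
  where
  open ≡-Reasoning
  P = suc m
  c′ = switchColoring τ c
  T = sgn ∘ τ
  cu = + toℕ (c u)
  cv = + toℕ (c v)

switch-HasColoring : ∀ {G} {s s′ : Signature G} {τ} {p d} → Switching s s′ τ →
  HasColoring s p d → HasColoring s′ p d
switch-HasColoring {τ = τ} {suc m} sw (d≥1 , 2d≤p , c , col) =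
  d≥1 , 2d≤p , switchColoring τ c , switch-IsColoring m sw col
switch-HasColoring {p = zero} {d = suc d} sw (_ , () , _)

circuitSign : ∀ {G} → Signature G → Circuit G → Sign
circuitSign s C = ∏ (λ i → σ s (vtx C i) (vtx C (csuc i)))

parity-sum-tabulate : ∀ {m} (f : Fin m → ℕ) → parity (List.sum (tabulate f)) ≡ ∏ (parity ∘ f)
parity-sum-tabulate {zero} f = refl
parity-sum-tabulate {suc m} f = trans (parity-+ (f Fin.zero) _) (cong (parity (f Fin.zero) ·_) (parity-sum-tabulate (f ∘ Fin.suc)))

parity-negCount : ∀ {G} (s : Signature G) C → parity (negCount s C) ≡ circuitSign s C
parity-negCount s C = begin
  parity (List.sum (map (negInd ∘ edgeSign) (tabulate (λ i → i))))
    ≡⟨ cong (parity ∘ List.sum) (map-tabulate (λ i → i) (negInd ∘ edgeSign)) ⟩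
  parity (List.sum (tabulate (negInd ∘ edgeSign)))
    ≡⟨ parity-sum-tabulate (negInd ∘ edgeSign) ⟩
  ∏ (parity ∘ negInd ∘ edgeSign)
    ≡⟨ ∏-cong (parity-negInd ∘ edgeSign) ⟩
  circuitSign s C ∎
  where
  open ≡-Reasoning
  edgeSign = λ i → σ s (vtx C i) (vtx C (csuc i))

balancedCircuit⇔ : ∀ {G} (s : Signature G) C → BalancedCircuit s C ⇔ circuitSign s C ≡ pos
balancedCircuit⇔ s C = mk⇔
  (λ even → trans (sym (parity-negCount s C)) (even⇒parity≡pos even))
  (λ positive → parity≡pos⇒even (negCount s C) (trans (parity-negCount s C) positive))

switching-circuitSign : ∀ {G} {s s′ : Signature G} {τ} → Switching s s′ τ →
  ∀ C → circuitSign s′ C ≡ circuitSign s C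
switching-circuitSign {s = s} {s′} {τ} sw C = begin
  ∏ (λ i → σ s′ (w i) (w (csuc i)))
    ≡⟨ ∏-cong (λ i → switched sw (w i) (w (csuc i)) (edge C i)) ⟩
  ∏ (λ i → τ (w i) · e i · τ (w (csuc i)))
    ≡⟨ ∏-distrib-· (λ i → τ (w i) · e i) (τ ∘ w ∘ csuc) ⟩
  ∏ (λ i → τ (w i) · e i) · ∏ (τ ∘ w ∘ csuc)
    ≡⟨ cong₂ _·_ (∏-distrib-· (τ ∘ w) e) (sum-∘csuc ·-commutativeMonoid (τ ∘ w)) ⟩
  ∏ (τ ∘ w) · circuitSign s C · ∏ (τ ∘ w)
    ≡⟨ cancel (∏ (τ ∘ w)) (circuitSign s C) ⟩
  circuitSign s C ∎
  where
  open ≡-Reasoning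
  w = vtx C
  e = λ i → σ s (w i) (w (csuc i))
  cancel : ∀ a b → a · b · a ≡ b
  cancel pos pos = refl
  cancel pos neg = refl
  cancel neg pos = refl
  cancel neg neg = refl

2-colorable⇔bipartite : ∀ {G} (s : Signature G) → HasColoring s 2 1 ⇔ Bipartite G
2-colorable⇔bipartite {G} s = mk⇔ to from
  where
  toBool : Fin 2 → Bool
  toBool Fin.zero = false
  toBool (Fin.suc _) = true
  fromBool : Bool → Fin 2
  fromBool false = Fin.zero
  fromBool true = Fin.suc Fin.zero
  distinct : ∀ a b t → 1 ≤ ∣ + toℕ a ℤ.- sgn t ℤ.* + toℕ b ∣[ 2 ] → toBool a ≢ toBool b
  distinct Fin.zero Fin.zero pos ()
  distinct Fin.zero Fin.zero neg ()
  distinct (Fin.suc Fin.zero) (Fin.suc Fin.zero) pos ()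
  distinct (Fin.suc Fin.zero) (Fin.suc Fin.zero) neg ()
  distinct Fin.zero (Fin.suc Fin.zero) t _ ()
  distinct (Fin.suc Fin.zero) Fin.zero t _ ()
  separated : ∀ a b t → a ≢ b → 1 ≤ ∣ + toℕ (fromBool a) ℤ.- sgn t ℤ.* + toℕ (fromBool b) ∣[ 2 ]
  separated false false t a≢b = contradiction refl a≢b
  separated true true t a≢b = contradiction refl a≢b
  separated false true pos _ = s≤s z≤n
  separated false true neg _ = s≤s z≤n
  separated true false pos _ = s≤s z≤n
  separated true false neg _ = s≤s z≤n
  to : HasColoring s 2 1 → Bipartite G
  to (_ , _ , c , col) = toBool ∘ c , λ u v adj → distinct (c u) (c v) (σ s u v) (col u v adj)
  from : Bipartite G → HasColoring s 2 1
  from (f , f-proper) = s≤s z≤n , s≤s (s≤s z≤n) , fromBool ∘ f ,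
    λ u v adj → separated (f u) (f v) (σ s u v) (f-proper u v adj)

toℚᵘ-/ : ∀ a b → toℚᵘ (+ a / suc b) ℚᵘ.≃ mkℚᵘ (+ a) b
toℚᵘ-/ a b = ℚP.toℚᵘ-fromℚᵘ (mkℚᵘ (+ a) b)

/≤/-cross : ∀ a b c d .{{_ : NonZero b}} .{{_ : NonZero d}} → a ℕ.* d ≤ c ℕ.* b → (+ a / b) ℚ.≤ (+ c / d)
/≤/-cross a (suc b) c (suc d) ad≤cb = ℚP.toℚᵘ-cancel-≤
  (ℚᵘP.≤-respˡ-≃ (ℚᵘP.≃-sym (toℚᵘ-/ a b)) (ℚᵘP.≤-respʳ-≃ (ℚᵘP.≃-sym (toℚᵘ-/ c d))
    (*≤* (subst₂ ℤ._≤_ (ℤP.pos-* a (suc d)) (ℤP.pos-* c (suc b)) (+≤+ ad≤cb)))))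

2+1/k≡[2k+1]/k : ∀ k .{{_ : NonZero k}} → (+ 2 / 1) ℚ.+ (+ 1 / k) ≡ + suc (2 ℕ.* k) / k
2+1/k≡[2k+1]/k (suc k) = ℚP.toℚᵘ-injective (begin
  toℚᵘ ((+ 2 / 1) ℚ.+ (+ 1 / suc k))           ≈⟨ ℚP.toℚᵘ-homo-+ (+ 2 / 1) (+ 1 / suc k) ⟩
  toℚᵘ (+ 2 / 1) ℚᵘ.+ toℚᵘ (+ 1 / suc k)       ≈⟨ ℚᵘP.+-cong (toℚᵘ-/ 2 0) (toℚᵘ-/ 1 k) ⟩
  mkℚᵘ (+ 2) 0 ℚᵘ.+ mkℚᵘ (+ 1) k               ≈⟨ *≡* (cong +_ (cross-product k)) ⟩
  mkℚᵘ (+ suc (2 ℕ.* suc k)) k                 ≈⟨ ℚᵘP.≃-sym (toℚᵘ-/ (suc (2 ℕ.* suc k)) k) ⟩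
  toℚᵘ (+ suc (2 ℕ.* suc k) / suc k)           ∎)
  where
  open ℚᵘP.≃-Reasoning
  cross-product : ∀ k → (2 ℕ.* suc k ℕ.+ 1) ℕ.* suc k ≡ suc (2 ℕ.* suc k) ℕ.* (1 ℕ.* suc k)
  cross-product = ℕSolver.solve-∀

isCircularChromaticNumber : ∀ {G} (s : Signature G) a b .{{_ : NonZero b}} {p₀ q₀} →
  (∀ {p q} → HasColoring s p q → a ℕ.* q ≤ p ℕ.* b) →
  HasColoring s p₀ q₀ → p₀ ℕ.* b ≤ a ℕ.* q₀ → IsCircularChromaticNumber s (+ a / b)
isCircularChromaticNumber s a b {p₀} {suc d₀} bound col₀ p₀b≤aq₀ = lower , upper
  where
  lower : ∀ p q → HasColoring s p q → (+ a / b) ℚ.≤ frac p q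
  lower p (suc d) col = /≤/-cross a b p (suc d) (bound col)
  upper : ∀ r → (+ a / b) ℚ.< r → ∃₂ λ p q → HasColoring s p q × frac p q ℚ.< r
  upper r a/b<r = p₀ , suc d₀ , col₀ , ℚP.≤-<-trans (/≤/-cross p₀ (suc d₀) a b p₀b≤aq₀) a/b<r

isCircularChromaticNumber-2 : ∀ {G} (s : Signature G) {p₀ q₀} →
  HasColoring s p₀ q₀ → p₀ ℕ.* 1 ≤ 2 ℕ.* q₀ → IsCircularChromaticNumber s (+ 2 / 1)
isCircularChromaticNumber-2 s = isCircularChromaticNumber s 2 1
  (λ {p} {q} (_ , 2q≤p , _) → subst (2 ℕ.* q ≤_) (sym (ℕP.*-identityʳ p)) 2q≤p)

-- The odd cycle

wrapSign : Sign → Sign → Sign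
wrapSign h pos = h
wrapSign h neg = pos

alternating : ℕ → ℤ
alternating = sgn ∘ parity

∣alternating-difference∣ : ∀ m j → ∣ alternating j ℤ.- alternating (suc j) ∣[ suc m ] ≡ ∣ + 2 ∣[ suc m ]
∣alternating-difference∣ m zero = refl
∣alternating-difference∣ m (suc zero) = ∣∣-neg m (+ 2)
∣alternating-difference∣ m (suc (suc j)) = ∣alternating-difference∣ m j

module OddCycle (k : ℕ) .{{_ : NonZero k}} where

  V : Set
  V = Fin (suc (2 ℕ.* k))

  csuc-step : ∀ (i : V) → CStep k i (csuc i)
  csuc-step i with toℕ i ℕP.<? 2 ℕ.* k
  ... | yes i<2k = inj₁ (sym (FinP.toℕ-fromℕ< (s≤s i<2k)))
  ... | no i≮2k = inj₂ (ℕP.≤-antisym (ℕP.≤-pred (FinP.toℕ<n i)) (ℕP.≮⇒≥ i≮2k) , refl)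

  cycle-adjacency : ∀ {R : V → V → Set} → (∀ {u v} → CStep k u v → R u v → R v u) →
    (∀ {u v} → CStep k u v → R u v) → ∀ u v → Adj (Cycle k) u v → R u v
  cycle-adjacency flip step u v (inj₁ st) = step st
  cycle-adjacency flip step u v (inj₂ st) = flip st (step st)

  vertex : ℕ → V
  vertex j = j mod suc (2 ℕ.* k)

  vertex-toℕ : ∀ u → vertex (toℕ u) ≡ u
  vertex-toℕ u = FinP.toℕ-injective (trans (FinP.toℕ-fromℕ< _) (m<n⇒m%n≡m (FinP.toℕ<n u)))

  -- Positive except on {2k, 0}, which carries h: the only edge whose endpoints have indices of equal parity.
  standard : Sign → Signature (Cycle k)
  standard h = record
    { σ = λ u v → wrapSign h (parity (toℕ u ℕ.+ toℕ v))
    ; σ-sym = λ u v _ → cong (wrapSign h ∘ parity) (ℕP.+-comm (toℕ u) (toℕ v)) }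

  standard-path : ∀ h {u v} → suc (toℕ u) ≡ toℕ v → σ (standard h) u v ≡ pos
  standard-path h {u} {v} 1+u≡v =
    cong (wrapSign h) (trans (cong (λ b → parity (toℕ u ℕ.+ b)) (sym 1+u≡v)) (parity-odd (toℕ u)))
    where
    parity-odd : ∀ a → parity (a ℕ.+ suc a) ≡ neg
    parity-odd a = trans (cong parity (ℕP.+-suc a a))
      (trans (parity-suc (a ℕ.+ a)) (cong (neg ·_) (trans (parity-+ a a) (·-inverse (parity a)))))

  standard-wrap : ∀ h {u v} → toℕ u ≡ 2 ℕ.* k → toℕ v ≡ 0 → σ (standard h) u v ≡ h
  standard-wrap h {u} {v} u≡2k v≡0 = cong (wrapSign h) (begin
    parity (toℕ u ℕ.+ toℕ v)   ≡⟨ cong₂ (λ a b → parity (a ℕ.+ b)) u≡2k v≡0 ⟩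
    parity (2 ℕ.* k ℕ.+ 0)     ≡⟨ cong parity (trans (ℕP.+-identityʳ (2 ℕ.* k)) (ℕP.*-comm 2 k)) ⟩
    parity (k ℕ.* 2)           ≡⟨ parity-*2 k ⟩
    pos                     ∎)
    where open ≡-Reasoning

  standard-pos : ∀ u v → σ (standard pos) u v ≡ pos
  standard-pos u v with parity (toℕ u ℕ.+ toℕ v)
  ... | pos = refl
  ... | neg = refl

  ∏-standard : ∀ h → ∏ (λ i → σ (standard h) i (csuc i)) ≡ h
  ∏-standard h = begin
    ∏ (λ i → σ (standard h) i (csuc i))
      ≡⟨ ∏-init-last (λ i → σ (standard h) i (csuc i)) ⟩
    ∏ (λ j → σ (standard h) (inject₁ j) (csuc (inject₁ j))) · σ (standard h) last (csuc last)
      ≡⟨ cong₂ _·_ (∏-cong (standard-path h ∘ path-edge)) wrap-edge ⟩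
    ∏ {2 ℕ.* k} (λ _ → pos) · h
      ≡⟨ cong (_· h) (∏-replicate-pos (2 ℕ.* k)) ⟩
    h ∎
    where
    open ≡-Reasoning
    last = fromℕ (2 ℕ.* k)
    path-edge : ∀ j → suc (toℕ (inject₁ j)) ≡ toℕ (csuc (inject₁ j))
    path-edge j = trans (cong suc (FinP.toℕ-inject₁ j)) (cong toℕ (sym (csuc-inject₁ j)))
    wrap-edge : σ (standard h) last (csuc last) ≡ h
    wrap-edge = standard-wrap h (FinP.toℕ-fromℕ _) (cong toℕ (csuc-last last (FinP.toℕ-fromℕ _)))

  standard-IsColoring : ∀ h m d (ℓ : ℕ → ℤ) →
    (∀ j → d ≤ ∣ ℓ j ℤ.- ℓ (suc j) ∣[ suc m ]) →
    d ≤ ∣ ℓ (2 ℕ.* k) ℤ.- sgn h ℤ.* ℓ 0 ∣[ suc m ] →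
    IsColoring (standard h) (suc m) d (residue m ∘ ℓ ∘ toℕ)
  standard-IsColoring h m d ℓ path wrap = cycle-adjacency flip step
    where
    P = suc m
    c = residue m ∘ ℓ ∘ toℕ
    Gap : V → V → Set
    Gap u v = d ≤ ∣ + toℕ (c u) ℤ.- sgn (σ (standard h) u v) ℤ.* + toℕ (c v) ∣[ P ]
    residues : ∀ u v → ∣ + toℕ (c u) ℤ.- sgn (σ (standard h) u v) ℤ.* + toℕ (c v) ∣[ P ]
                     ≡ ∣ ℓ (toℕ u) ℤ.- sgn (σ (standard h) u v) ℤ.* ℓ (toℕ v) ∣[ P ]
    residues u v = trans (cong₂ (λ a b → ∣ + a ℤ.- sgn (σ (standard h) u v) ℤ.* + b ∣[ P ])
                                 (toℕ-residue m (ℓ (toℕ u))) (toℕ-residue m (ℓ (toℕ v))))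
                         (∣∣-residues m (sgn (σ (standard h) u v)) (ℓ (toℕ u)) (ℓ (toℕ v)))
    flip : ∀ {u v} → CStep k u v → Gap u v → Gap v u
    flip {u} {v} st gap = subst (d ≤_)
      (trans (∣∣-swap m (σ (standard h) u v) (+ toℕ (c v)) (+ toℕ (c u)))
             (cong (λ t → ∣ + toℕ (c v) ℤ.- sgn t ℤ.* + toℕ (c u) ∣[ P ]) (σ-sym (standard h) u v (inj₁ st))))
      gap
    step : ∀ {u v} → CStep k u v → Gap u v
    step {u} {v} (inj₁ 1+u≡v) = subst (d ≤_) (sym (trans (residues u v)
      (cong₂ (λ t b → ∣ ℓ (toℕ u) ℤ.- sgn t ℤ.* ℓ b ∣[ P ]) (standard-path h 1+u≡v) (sym 1+u≡v))))
      (subst (λ x → d ≤ ∣ ℓ (toℕ u) ℤ.- x ∣[ P ]) (sym (ℤP.*-identityˡ (ℓ (suc (toℕ u))))) (path (toℕ u)))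
    step {u} {v} (inj₂ (u≡2k , v≡0)) = subst (d ≤_) (sym (trans (residues u v)
      (trans (cong₂ (λ a b → ∣ ℓ a ℤ.- sgn (σ (standard h) u v) ℤ.* ℓ b ∣[ P ]) u≡2k v≡0)
             (cong (λ t → ∣ ℓ (2 ℕ.* k) ℤ.- sgn t ℤ.* ℓ 0 ∣[ P ]) (standard-wrap h u≡2k v≡0)))))
      wrap

  standard-3-coloring : ∀ h → HasColoring (standard h) 3 1
  -- Labels 0, −1, 1, −1, …, 1: the edge {2k, 0} joins 1 and 0, whatever its sign.
  standard-3-coloring h = s≤s z≤n , s≤s (s≤s z≤n) , _ , standard-IsColoring h 2 1 ℓ path wrap
    where
    ℓ : ℕ → ℤ
    ℓ zero = + 0
    ℓ (suc j) = alternating (suc j)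
    path : ∀ j → 1 ≤ ∣ ℓ j ℤ.- ℓ (suc j) ∣[ 3 ]
    path zero = s≤s z≤n
    path (suc j) = subst (1 ≤_) (sym (∣alternating-difference∣ 2 (suc j))) (s≤s z≤n)
    ℓ-even : ∀ j → ℓ (suc j ℕ.* 2) ≡ + 1
    ℓ-even j = cong sgn (parity-*2 j)
    wrap : 1 ≤ ∣ ℓ (2 ℕ.* k) ℤ.- sgn h ℤ.* + 0 ∣[ 3 ]
    wrap = subst (λ x → 1 ≤ ∣ x ℤ.- sgn h ℤ.* + 0 ∣[ 3 ]) (sym (trans (cong ℓ 2k≡) (ℓ-even (ℕ.pred k)))) (lemma h)
      where
      2k≡ : 2 ℕ.* k ≡ suc (ℕ.pred k) ℕ.* 2
      2k≡ = trans (ℕP.*-comm 2 k) (cong (ℕ._* 2) (sym (ℕP.suc-pred k)))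
      lemma : ∀ h → 1 ≤ ∣ + 1 ℤ.- sgn h ℤ.* + 0 ∣[ 3 ]
      lemma pos = s≤s z≤n
      lemma neg = s≤s z≤n

  standard-4-2-coloring : HasColoring (standard neg) 4 2
  standard-4-2-coloring = s≤s z≤n , ℕP.≤-refl , _ , standard-IsColoring neg 3 2 alternating path wrap
    where
    path : ∀ j → 2 ≤ ∣ alternating j ℤ.- alternating (suc j) ∣[ 4 ]
    path j = subst (2 ≤_) (sym (∣alternating-difference∣ 3 j)) ℕP.≤-refl
    wrap : 2 ≤ ∣ alternating (2 ℕ.* k) ℤ.- sgn neg ℤ.* alternating 0 ∣[ 4 ]
    wrap = subst (λ t → 2 ≤ ∣ sgn t ℤ.- sgn neg ℤ.* alternating 0 ∣[ 4 ])
      (sym (trans (cong parity (ℕP.*-comm 2 k)) (parity-*2 k))) ℕP.≤-refl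

  standard-circular-coloring : HasColoring (standard pos) (suc (2 ℕ.* k)) k
  standard-circular-coloring = k≥1 , ℕP.n≤1+n _ , _ , standard-IsColoring pos (2 ℕ.* k) k ℓ path wrap
    where
    P = suc (2 ℕ.* k)
    k≥1 : 1 ≤ k
    k≥1 = ℕ.>-nonZero⁻¹ k
    ℓ : ℕ → ℤ
    ℓ j = + (j ℕ.* k)
    k≤∣k∣ : k ≤ ∣ + k ∣[ P ]
    k≤∣k∣ = Equivalence.from (≤∣∣⇔ (2 ℕ.* k) (+ k) k≥1)
      ( ℕP.≤-reflexive (sym k%P≡k)
      , subst (λ r → r ℕ.+ k ≤ P) (sym k%P≡k)
          (ℕP.≤-trans (ℕP.≤-reflexive (cong (k ℕ.+_) (sym (ℕP.+-identityʳ k)))) (ℕP.n≤1+n (2 ℕ.* k))))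
      where
      k%P≡k : k ℕ.% P ≡ k
      k%P≡k = m<n⇒m%n≡m (s≤s (ℕP.m≤m+n k (k ℕ.+ 0)))
    path : ∀ j → k ≤ ∣ ℓ j ℤ.- ℓ (suc j) ∣[ P ]
    path j = subst (k ≤_) (sym (begin
      ∣ ℓ j ℤ.- + (k ℕ.+ j ℕ.* k) ∣[ P ]   ≡⟨ cong (λ x → ∣ ℓ j ℤ.- x ∣[ P ]) (ℤP.pos-+ k (j ℕ.* k)) ⟩
      ∣ ℓ j ℤ.- (+ k ℤ.+ ℓ j) ∣[ P ]       ≡⟨ cong ∣_∣[ P ] (difference (ℓ j) (+ k)) ⟩
      ∣ - + k ∣[ P ]                       ≡⟨ ∣∣-neg (2 ℕ.* k) (+ k) ⟩
      ∣ + k ∣[ P ]                         ∎)) k≤∣k∣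
      where
      open ≡-Reasoning
      difference : ∀ a b → a ℤ.- (b ℤ.+ a) ≡ - b
      difference = solve-∀
    wrap : k ≤ ∣ ℓ (2 ℕ.* k) ℤ.- sgn pos ℤ.* ℓ 0 ∣[ P ]
    wrap = subst (k ≤_) (sym (begin
      ∣ + (2 ℕ.* k ℕ.* k) ℤ.- + 1 ℤ.* + 0 ∣[ P ]        ≡⟨ cong (λ x → ∣ x ℤ.- + 1 ℤ.* + 0 ∣[ P ])
                                                             (trans (ℤP.pos-* (2 ℕ.* k) k) (cong (ℤ._* + k) (ℤP.pos-* 2 k))) ⟩
      ∣ + 2 ℤ.* + k ℤ.* + k ℤ.- + 1 ℤ.* + 0 ∣[ P ]     ≡⟨ cong ∣_∣[ P ] (multiple (+ k)) ⟩
      ∣ - + k ℤ.+ + k ℤ.* (+ 1 ℤ.+ + 2 ℤ.* + k) ∣[ P ] ≡⟨ cong (λ x → ∣ - + k ℤ.+ + k ℤ.* x ∣[ P ])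
                                                             (trans (cong (ℤ._+_ (+ 1)) (sym (ℤP.pos-* 2 k)))
                                                                    (sym (ℤP.pos-+ 1 (2 ℕ.* k)))) ⟩
      ∣ - + k ℤ.+ + k ℤ.* + P ∣[ P ]                    ≡⟨ ∣∣-+-* (2 ℕ.* k) (- + k) (+ k) ⟩
      ∣ - + k ∣[ P ]                                    ≡⟨ ∣∣-neg (2 ℕ.* k) (+ k) ⟩
      ∣ + k ∣[ P ]                                      ∎)) k≤∣k∣
      where
      open ≡-Reasoning
      multiple : ∀ x → + 2 ℤ.* x ℤ.* x ℤ.- + 1 ℤ.* + 0 ≡ - x ℤ.+ x ℤ.* (+ 1 ℤ.+ + 2 ℤ.* x)
      multiple = solve-∀

  standard-pos-bound : ∀ {p q} → HasColoring (standard pos) p q → suc (2 ℕ.* k) ℕ.* q ≤ k ℕ.* p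
  standard-pos-bound {suc m} {q} (q≥1 , _ , c , col) = odd-cyclic-sequence-bound m k q≥1 x gap
    where
    x : V → ℤ
    x i = + toℕ (c i)
    gap : ∀ i → q ≤ ∣ x (csuc i) ℤ.- x i ∣[ suc m ]
    gap i = subst (q ≤_) (begin
      ∣ x i ℤ.- sgn (σ (standard pos) i (csuc i)) ℤ.* x (csuc i) ∣[ suc m ]
        ≡⟨ cong (λ t → ∣ x i ℤ.- sgn t ℤ.* x (csuc i) ∣[ suc m ]) (standard-pos i (csuc i)) ⟩
      ∣ x i ℤ.- sgn pos ℤ.* x (csuc i) ∣[ suc m ]
        ≡⟨ ∣∣-swap m pos (x (csuc i)) (x i) ⟩
      ∣ x (csuc i) ℤ.- sgn pos ℤ.* x i ∣[ suc m ]
        ≡⟨ cong (λ y → ∣ x (csuc i) ℤ.- y ∣[ suc m ]) (ℤP.*-identityˡ (x i)) ⟩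
      ∣ x (csuc i) ℤ.- x i ∣[ suc m ] ∎)
      (col i (csuc i) (inj₁ (csuc-step i)))
      where open ≡-Reasoning
  standard-pos-bound {zero} {suc q} (_ , () , _)

  not-bipartite : ¬ Bipartite (Cycle k)
  not-bipartite bipartite = ℕP.<-irrefl refl (begin-strict
    2 ℕ.* k                   <⟨ ℕP.n<1+n (2 ℕ.* k) ⟩
    suc (2 ℕ.* k)             ≡⟨ sym (ℕP.*-identityʳ (suc (2 ℕ.* k))) ⟩
    suc (2 ℕ.* k) ℕ.* 1       ≤⟨ standard-pos-bound (Equivalence.from (2-colorable⇔bipartite (standard pos)) bipartite) ⟩
    k ℕ.* 2                   ≡⟨ ℕP.*-comm k 2 ⟩
    2 ℕ.* k                   ∎)
    where open ℕP.≤-Reasoning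

  hamiltonian-length : suc (suc (suc (ℕ.pred k ℕ.+ ℕ.pred k))) ≡ suc (2 ℕ.* k)
  hamiltonian-length = trans (shape (ℕ.pred k)) (cong (λ j → suc (2 ℕ.* j)) (ℕP.suc-pred k))
    where
    shape : ∀ j → suc (suc (suc (j ℕ.+ j))) ≡ suc (2 ℕ.* suc j)
    shape = ℕSolver.solve-∀

  hamiltonian : Circuit (Cycle k)
  hamiltonian = record
    { l = ℕ.pred k ℕ.+ ℕ.pred k
    ; vtx = cast L
    ; inj = λ {i} {j} eq → FinP.toℕ-injective (trans (sym (FinP.toℕ-cast L i)) (trans (cong toℕ eq) (FinP.toℕ-cast L j)))
    ; edge = λ i → inj₁ (subst (CStep k (cast L i)) (csuc-cast L i) (csuc-step (cast L i)))
    }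
    where L = hamiltonian-length

  circuitSign-hamiltonian : ∀ s → circuitSign s hamiltonian ≡ ∏ (λ i → σ s i (csuc i))
  circuitSign-hamiltonian s = trans
    (∏-cong (λ i → cong (σ s (cast L i)) (sym (csuc-cast L i))))
    (sum-∘cast ·-commutativeMonoid L (λ i → σ s i (csuc i)))
    where L = hamiltonian-length

  circuitSign-standard-pos : ∀ C → circuitSign (standard pos) C ≡ pos
  circuitSign-standard-pos C =
    trans (∏-cong (λ i → standard-pos (vtx C i) (vtx C (csuc i)))) (∏-replicate-pos (suc (suc (suc (l C)))))

  module _ (s : Signature (Cycle k)) where

    pathSign : ℕ → Sign
    pathSign zero = pos
    pathSign (suc j) = pathSign j · σ s (vertex j) (vertex (suc j))

    potential : V → Sign
    potential u = pathSign (toℕ u)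

    holonomy : Sign
    holonomy = pathSign (2 ℕ.* k) · σ s (vertex (2 ℕ.* k)) (vertex 0)

    switching-standard : Switching (standard holonomy) s potential
    switching-standard = record { switched = cycle-adjacency flip step }
      where
      Switched-at : V → V → Set
      Switched-at u v = σ s u v ≡ potential u · σ (standard holonomy) u v · potential v
      flip : ∀ {u v} → CStep k u v → Switched-at u v → Switched-at v u
      flip {u} {v} st eq = begin
        σ s v u                                                           ≡⟨ σ-sym s v u (inj₂ st) ⟩
        σ s u v                                                           ≡⟨ eq ⟩
        potential u · σ (standard holonomy) u v · potential v             ≡⟨ reverse (potential u) _ (potential v) ⟩
        potential v · σ (standard holonomy) u v · potential u             ≡⟨ cong (λ t → potential v · t · potential u)
                                                                               (σ-sym (standard holonomy) u v (inj₁ st)) ⟩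
        potential v · σ (standard holonomy) v u · potential u             ∎
        where
        open ≡-Reasoning
        reverse : ∀ a b c → a · b · c ≡ c · b · a
        reverse a b c = trans (·-comm (a · b) c) (trans (cong (c ·_) (·-comm a b)) (sym (·-assoc c b a)))
      step : ∀ {u v} → CStep k u v → Switched-at u v
      step {u} {v} (inj₁ 1+u≡v) = begin
        σ s u v                                                  ≡⟨ sym (·-cancelˡ (potential u) (σ s u v)) ⟩
        potential u · (potential u · σ s u v)                    ≡⟨ cong (_· (potential u · σ s u v))
                                                                      (sym (·-identityʳ (potential u))) ⟩
        potential u · pos · (potential u · σ s u v)              ≡⟨ cong₂ (λ t w → potential u · t · w)
                                                                      (sym (standard-path holonomy 1+u≡v)) (sym potential-step) ⟩
        potential u · σ (standard holonomy) u v · potential v    ∎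
        where
        open ≡-Reasoning
        potential-step : potential v ≡ potential u · σ s u v
        potential-step = trans (cong pathSign (sym 1+u≡v))
          (cong₂ (λ a b → potential u · σ s a b) (vertex-toℕ u) (trans (cong vertex 1+u≡v) (vertex-toℕ v)))
      step {u} {v} (inj₂ (u≡2k , v≡0)) = begin
        σ s u v                                                  ≡⟨ sym (·-cancelˡ (potential u) (σ s u v)) ⟩
        potential u · (potential u · σ s u v)                    ≡⟨ sym (·-identityʳ _) ⟩
        potential u · (potential u · σ s u v) · pos              ≡⟨ cong₂ (λ t w → potential u · t · w)
                                                                      (trans (cong₂ _·_ (cong pathSign u≡2k) wrap-edge)
                                                                             (sym (standard-wrap holonomy u≡2k v≡0)))
                                                                      (sym (cong pathSign v≡0)) ⟩
        potential u · σ (standard holonomy) u v · potential v    ∎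
        where
        open ≡-Reasoning
        wrap-edge : σ s u v ≡ σ s (vertex (2 ℕ.* k)) (vertex 0)
        wrap-edge = cong₂ (σ s) (trans (sym (vertex-toℕ u)) (cong vertex u≡2k))
                                (trans (sym (vertex-toℕ v)) (cong vertex v≡0))

    balanced⇒holonomy≡pos : Balanced s → holonomy ≡ pos
    balanced⇒holonomy≡pos balanced = begin
      holonomy                                      ≡⟨ sym (∏-standard holonomy) ⟩
      ∏ (λ i → σ (standard holonomy) i (csuc i))    ≡⟨ sym (circuitSign-hamiltonian (standard holonomy)) ⟩
      circuitSign (standard holonomy) hamiltonian   ≡⟨ sym (switching-circuitSign switching-standard hamiltonian) ⟩
      circuitSign s hamiltonian                     ≡⟨ Equivalence.to (balancedCircuit⇔ s hamiltonian) (balanced hamiltonian) ⟩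
      pos                                           ∎
      where open ≡-Reasoning

    holonomy≡pos⇒balanced : holonomy ≡ pos → Balanced s
    holonomy≡pos⇒balanced holonomy≡pos C = Equivalence.from (balancedCircuit⇔ s C) (begin
      circuitSign s C                     ≡⟨ switching-circuitSign switching-standard C ⟩
      circuitSign (standard holonomy) C   ≡⟨ cong (λ h → circuitSign (standard h) C) holonomy≡pos ⟩
      circuitSign (standard pos) C        ≡⟨ circuitSign-standard-pos C ⟩
      pos                                 ∎)
      where open ≡-Reasoning

    3-colorable : HasColoring s 3 1
    3-colorable = switch-HasColoring switching-standard (standard-3-coloring holonomy)

    balanced-circular-coloring : Balanced s → HasColoring s (suc (2 ℕ.* k)) k
    balanced-circular-coloring balanced = switch-HasColoring switching-standard
      (subst (λ h → HasColoring (standard h) (suc (2 ℕ.* k)) k) (sym (balanced⇒holonomy≡pos balanced))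
        standard-circular-coloring)

    balanced-bound : Balanced s → ∀ {p q} → HasColoring s p q → suc (2 ℕ.* k) ℕ.* q ≤ k ℕ.* p
    balanced-bound balanced {p} {q} col = standard-pos-bound
      (subst (λ h → HasColoring (standard h) p q) (balanced⇒holonomy≡pos balanced)
        (switch-HasColoring (switching-sym switching-standard) col))

    unbalanced-4-2-coloring : ¬ Balanced s → HasColoring s 4 2
    unbalanced-4-2-coloring unbalanced = by-holonomy holonomy refl
      where
      by-holonomy : ∀ h → holonomy ≡ h → HasColoring s 4 2
      by-holonomy pos holonomy≡pos = contradiction (holonomy≡pos⇒balanced holonomy≡pos) unbalanced
      by-holonomy neg holonomy≡neg = switch-HasColoring switching-standard
        (subst (λ h → HasColoring (standard h) 4 2) (sym holonomy≡neg) standard-4-2-coloring)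

    chromatic-number : IsChromaticNumber s 3
    chromatic-number = 3-colorable , at-least-3
      where
      at-least-3 : ∀ j → HasColoring s j 1 → 3 ≤ j
      at-least-3 zero (_ , () , _)
      at-least-3 (suc zero) (_ , s≤s () , _)
      at-least-3 (suc (suc zero)) col = contradiction (Equivalence.to (2-colorable⇔bipartite s) col) not-bipartite
      at-least-3 (suc (suc (suc j))) _ = s≤s (s≤s (s≤s z≤n))

    balanced⇒circular : Balanced s → IsCircularChromaticNumber s ((+ 2 / 1) + (+ 1 / k))
    balanced⇒circular balanced = subst (IsCircularChromaticNumber s) (sym (2+1/k≡[2k+1]/k k))
      (isCircularChromaticNumber s (suc (2 ℕ.* k)) k
        (λ {p} col → ℕP.≤-trans (balanced-bound balanced col) (ℕP.≤-reflexive (ℕP.*-comm k p)))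
        (balanced-circular-coloring balanced) ℕP.≤-refl)

    unbalanced⇒circular : ¬ Balanced s → IsCircularChromaticNumber s (+ 2 / 1)
    unbalanced⇒circular unbalanced = isCircularChromaticNumber-2 s (unbalanced-4-2-coloring unbalanced) ℕP.≤-refl

chromatic-2⇔bipartite : ∀ {G} (s : Signature G) → IsChromaticNumber s 2 ⇔ Bipartite G
chromatic-2⇔bipartite s = mk⇔
  (λ (col , _) → Equivalence.to (2-colorable⇔bipartite s) col)
  (λ bipartite → Equivalence.from (2-colorable⇔bipartite s) bipartite , λ _ col → proj₁ (proj₂ col))

bipartite⇒circular≡chromatic : ∀ {G} (s : Signature G) → Bipartite G →
  ∀ m → IsChromaticNumber s m → IsCircularChromaticNumber s (+ m / 1)
bipartite⇒circular≡chromatic s bipartite m (m-col , m-minimal) =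
  subst (λ j → IsCircularChromaticNumber s (+ j / 1)) (sym (ℕP.≤-antisym (m-minimal 2 2-col) (proj₁ (proj₂ m-col))))
    (isCircularChromaticNumber-2 s 2-col ℕP.≤-refl)
  where 2-col = Equivalence.from (2-colorable⇔bipartite s) bipartite

proposition20 :
    ((k : ℕ) .{{_ : NonZero k}} (s : Signature (Cycle k)) →
        (Balanced s → IsCircularChromaticNumber s ((+ 2 / 1) + (+ 1 / k)))
      × (¬ Balanced s → IsCircularChromaticNumber s (+ 2 / 1))
      × IsChromaticNumber s 3)
    ×
    ((G : Graph) (s : Signature G) →
        (IsChromaticNumber s 2 ⇔ Bipartite G)
      × (Bipartite G → ∀ m → IsChromaticNumber s m → IsCircularChromaticNumber s (+ m / 1)))
proposition20 =
  (λ k s → let open OddCycle k in balanced⇒circular s , unbalanced⇒circular s , chromatic-number s) ,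
  (λ G s → chromatic-2⇔bipartite s , bipartite⇒circular≡chromatic s)
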